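{- Let $p$ be an odd prime, $n\ge1$, $\alpha\in(\mathbb Z/p^n)^\times$, $\varepsilon\in\{\pm1\}$ and integers $0\le b_1\le b_2\le n$. Let $D=\left\{\begin{pmatrix}\alpha^i&p^{b_1}j\\0&\varepsilon^i\end{pmatrix}:0\le i<o'_\alpha,\ 0\le j<p^{n-b_1}\right\}$ and $I=\left\{\begin{pmatrix}1&p^{b_2}j\\0&1\end{pmatrix}:0\le j<p^{n-b_2}\right\}$, acting by left multiplication on $W=\left\{\binom{x}{y}:x,y\in\mathbb Z/p^n,\ v(x)=0\text{ or }v(y)=0\right\}$. For $w=\binom{x}{y}\in W$ the stabilizer of $w$ in $D$ has order $$\#\mathrm{St}_{D,w}=\begin{cases}\frac{o'_\alpha}{o_\alpha}p^{n-b_1} & y=0,\\ \frac{o'_\alpha}{o_\varepsilon}p^{v(y)} & v(x)\ge b_1+v(y),\\ p^{\min\{n-b_1+v(x),\,n-v_\alpha+v(y)\}} & v(x)<b_1+v(y),\ y\ne0,\end{cases}$$ and the stabilizer of $w$ in $I$ has order $p^{\min\{v(y),n-b_2\}}$.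
   Context: For $x\in\mathbb Z/p^n$, $v(x)$ is the largest $e\le n$ with $p^e\mid x$ (so $v(0)=n$). $o_\alpha$ is the order of $\alpha$ in $(\mathbb Z/p^n)^\times$, $o_\varepsilon\in\{1,2\}$ the order of $\varepsilon$, and $o'_\alpha=\mathrm{lcm}(o_\alpha,o_\varepsilon)$. $o_{\bar\alpha}$ is the order of $\alpha\bmod p$ in $\mathbb F_p^\times$ and $v_\alpha=v(\alpha^{o_{\bar\alpha}}-1)$. -}

module Defs where

open import Data.Nat using (ℕ; zero; suc; _+_; _*_; _∸_; _^_; _≤_; _<_; _%_)
open import Data.Nat.Divisibility using (_∣_; _∣?_)
open import Data.Bool using (Bool; true; false; if_then_else_)
open import Relation.Nullary using (yes; no; does)
open import Relation.Binary.PropositionalEquality using (_≡_)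
open import Data.Product using (_×_)
open import Data.Nat using (_≡ᵇ_)

-- reduction of a modulo m (the representative in [0,m)); m = 0 is never used
md : ℕ → ℕ → ℕ
md a zero    = a
md a (suc k) = a % suc k

infix 4 _≡[mod_]_ _≡ᵇ[mod_]_
_≡[mod_]_ : ℕ → ℕ → ℕ → Set
a ≡[mod m ] b = md a m ≡ md b m

_≡ᵇ[mod_]_ : ℕ → ℕ → ℕ → Bool
a ≡ᵇ[mod m ] b = md a m ≡ᵇ md b m

-- v p x n : the largest e ≤ n with p^e ∣ x  (for x a representative of Z/p^n,
-- this is the valuation v(x) of the paper; in particular v(0) = n)
val : ℕ → ℕ → ℕ → ℕ
val p x zero = zero
val p x (suc e) with p ^ suc e ∣? x
... | yes _ = suc e
... | no  _ = val p x e

IsOrder : ℕ → ℕ → ℕ → Set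
IsOrder m a k =
  (0 < k) × (a ^ k ≡[mod m ] 1) × (∀ j → 0 < j → a ^ j ≡[mod m ] 1 → k ≤ j)

countBelow : ℕ → (ℕ → Bool) → ℕ
countBelow zero    P = zero
countBelow (suc k) P = (if P k then 1 else 0) + countBelow k P

sumBelow : ℕ → (ℕ → ℕ) → ℕ
sumBelow zero    f = zero
sumBelow (suc k) f = f k + sumBelow k f

-- Let N = p^n.  The matrix [[α^i, p^b j],[0, ε^i]] fixes (x,y) (column vector)
-- modulo N.
fixesD : (p n α ε b i j x y : ℕ) → Bool
fixesD p n α ε b i j x y =
  if ((α ^ i) * x + (p ^ b) * j * y) ≡ᵇ[mod p ^ n ] x
  then ((ε ^ i) * y) ≡ᵇ[mod p ^ n ] y
  else false

stabD : (p n α ε b₁ o' x y : ℕ) → ℕ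
stabD p n α ε b₁ o' x y =
  sumBelow o' (λ i → countBelow (p ^ (n ∸ b₁)) (λ j → fixesD p n α ε b₁ i j x y))

stabI : (p n b₂ x y : ℕ) → ℕ
stabI p n b₂ x y =
  countBelow (p ^ (n ∸ b₂)) (λ j → fixesD p n 1 1 b₂ 0 j x y)

module Submission where

-- For fixed i, a matrix of D with first index i fixes w iff ε^i y ≡ y and its j solves the linear
-- congruence p^n ∣ (α^i - 1) x + p^b₁ j y. Among 0 ≤ j < p^(n-b₁) this congruence has no solution unless
-- p^(b₁+μ) ∣ (α^i - 1) x, where μ = min(v(y), n - b₁), and then exactly p^μ of them. So #St_{D,w} is p^μ
-- times the number of i < o'_α satisfying both conditions on i, and each of them says d ∣ i for an explicit
-- d: o_ε for ε = ±1, and for α its order modulo a power p^k, which lifting the exponent (p odd) evaluates to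
-- o_ᾱ p^(k - v_α). The count is therefore o'_α divided by the lcm of these, and comparing powers of p gives
-- the three cases. The stabilizer in I is the case α = ε = 1, i = 0, where the condition on i always holds.

open import Defs
open import Data.Nat using (ℕ; zero; suc; _+_; _*_; _∸_; _^_; _≤_; _<_; _/_; NonZero)
open import Data.Nat.Primality using (Prime)
open import Data.Nat.Coprimality using (Coprime)
open import Data.Nat.LCM using (lcm)
open import Data.Nat.Base using (_⊓_)
open import Data.Product using (_×_)
open import Data.Sum using (_⊎_)
open import Relation.Nullary using (¬_)
open import Relation.Binary.PropositionalEquality using (_≡_)

open import Data.Bool using (Bool; true; false; if_then_else_; T)
open import Data.Empty using (⊥-elim)
open import Data.Nat using (z≤n; s≤s; z<s; _≟_; _≤?_; _%_)
open import Data.Nat.Base using (≢-nonZero; ≢-nonZero⁻¹; >-nonZero; >-nonZero⁻¹; nonTrivial⇒n>1)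
open import Data.Nat.Properties
open import Data.Nat.DivMod
open import Data.Nat.Divisibility
open import Data.Nat.Primality using (prime⇒nonZero; prime⇒nonTrivial; prime⇒irreducible)
open import Data.Nat.Coprimality using (coprime-divisor; coprime-Bézout; 1-coprimeTo)
  renaming (sym to coprime-sym)
open import Data.Nat.GCD using (module Bézout)
open import Data.Nat.LCM using (m∣lcm[m,n]; n∣lcm[m,n]; lcm-least)
open import Data.Nat.Tactic.RingSolver using (solve-∀)
open import Data.Product using (_,_; proj₁; proj₂; ∃-syntax; swap)
open import Data.Product.Function.NonDependent.Propositional using (_×-⇔_)
open import Data.Sum using (inj₁; inj₂; [_,_]′)
open import Data.Unit using (tt)
open import Function using (_∘_; const; _$_)
open import Function.Bundles using (_⇔_; mk⇔; Equivalence)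
open import Function.Properties.Equivalence using (⇔-setoid)
  renaming (refl to ⇔-refl; sym to ⇔-sym; trans to ⇔-trans)
open import Level using (0ℓ)
open import Relation.Nullary using (Dec; yes; no; does)
open import Relation.Nullary.Decidable using (does-⇔; _×-dec_)
open import Relation.Binary.PropositionalEquality
  using (refl; sym; trans; cong; cong₂; subst; subst₂; _≢_; module ≡-Reasoning)
import Relation.Binary.Reasoning.Setoid as SetoidReasoning

open Equivalence
module ⇔-Reasoning = SetoidReasoning (⇔-setoid 0ℓ)

private variable
  A : Set
  a b c d e f i k m n o p t u v x y z : ℕ

-- Booleans and counting

T-injective : ∀ {b c} → (T b ⇔ T c) → b ≡ c
T-injective {false} {false} _   = refl
T-injective {false} {true}  b⇔c = ⊥-elim (from b⇔c tt)
T-injective {true}  {false} b⇔c = ⊥-elim (to b⇔c tt)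
T-injective {true}  {true}  _   = refl

T-does : (a? : Dec A) → T (does a?) ⇔ A
T-does (yes a) = mk⇔ (const a) (const tt)
T-does (no ¬a) = mk⇔ (λ ()) ¬a

T-if-then-false : ∀ a {b} → T (if a then b else false) ⇔ (T a × T b)
T-if-then-false true  = mk⇔ (tt ,_) proj₂
T-if-then-false false = mk⇔ (λ ()) proj₁

if-T : ∀ {b} {x y : A} → T b → (if b then x else y) ≡ x
if-T {b = true} _ = refl

if-¬T : ∀ {b} {x y : A} → ¬ T b → (if b then x else y) ≡ y
if-¬T {b = false} _  = refl
if-¬T {b = true}  ¬b = ⊥-elim (¬b tt)

countBelow-cong : ∀ k {P Q : ℕ → Bool} → (∀ {t} → t < k → P t ≡ Q t) → countBelow k P ≡ countBelow k Q
countBelow-cong zero    _   = refl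
countBelow-cong (suc k) P≗Q =
  cong₂ (λ b n → (if b then 1 else 0) + n) (P≗Q ≤-refl) (countBelow-cong k (P≗Q ∘ m<n⇒m<1+n))

countBelow-none : ∀ k {P : ℕ → Bool} → (∀ {t} → t < k → ¬ T (P t)) → countBelow k P ≡ 0
countBelow-none zero    _  = refl
countBelow-none (suc k) ¬P = cong₂ _+_ (if-¬T (¬P ≤-refl)) (countBelow-none k (¬P ∘ m<n⇒m<1+n))

countBelow-all : ∀ k {P : ℕ → Bool} → (∀ {t} → t < k → T (P t)) → countBelow k P ≡ k
countBelow-all zero    _ = refl
countBelow-all (suc k) P = cong₂ _+_ (if-T (P ≤-refl)) (countBelow-all k (P ∘ m<n⇒m<1+n))

countBelow-const : ∀ k b → countBelow k (λ _ → b) ≡ (if b then k else 0)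
countBelow-const k true  = countBelow-all k (λ _ → tt)
countBelow-const k false = countBelow-none k (λ _ ())

countBelow-+ : ∀ a b (P : ℕ → Bool) → countBelow (a + b) P ≡ countBelow a (λ t → P (t + b)) + countBelow b P
countBelow-+ zero    b P = refl
countBelow-+ (suc a) b P = begin
  [a+b] + countBelow (a + b) P                                  ≡⟨ cong ([a+b] +_) (countBelow-+ a b P) ⟩
  [a+b] + (countBelow a (λ t → P (t + b)) + countBelow b P)     ≡⟨ +-assoc [a+b] _ _ ⟨
  [a+b] + countBelow a (λ t → P (t + b)) + countBelow b P       ∎
  where
  open ≡-Reasoning
  [a+b] = if P (a + b) then 1 else 0

countBelow-periodic : ∀ d {P : ℕ → Bool} → (∀ t → P (t + d) ≡ P t) →
  ∀ q → countBelow (q * d) P ≡ q * countBelow d P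
countBelow-periodic d {P} P-periodic zero    = refl
countBelow-periodic d {P} P-periodic (suc q) = begin
  countBelow (d + q * d) P
    ≡⟨ countBelow-+ d (q * d) P ⟩
  countBelow d (λ t → P (t + q * d)) + countBelow (q * d) P
    ≡⟨ cong₂ _+_ (countBelow-cong d (λ {t} _ → shift q t)) (countBelow-periodic d P-periodic q) ⟩
  countBelow d P + q * countBelow d P
    ∎
  where
  open ≡-Reasoning
  shift : ∀ q t → P (t + q * d) ≡ P t
  shift zero    t = cong P (+-identityʳ t)
  shift (suc q) t = begin
    P (t + (d + q * d)) ≡⟨ cong P (trans (cong (t +_) (+-comm d (q * d))) (sym (+-assoc t (q * d) d))) ⟩
    P (t + q * d + d)   ≡⟨ P-periodic (t + q * d) ⟩
    P (t + q * d)       ≡⟨ shift q t ⟩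
    P t                 ∎

countBelow-unique : ∀ k {P : ℕ → Bool} t₀ → t₀ < k → (∀ {t} → t < k → T (P t) ⇔ t ≡ t₀) → countBelow k P ≡ 1
countBelow-unique (suc k) t₀ t₀<1+k P⇔≡t₀ with k ≟ t₀
... | yes refl = cong₂ _+_ (if-T (from (P⇔≡t₀ ≤-refl) refl))
                           (countBelow-none k λ t<k Pt → <-irrefl (to (P⇔≡t₀ (m<n⇒m<1+n t<k)) Pt) t<k)
... | no  k≢t₀ = cong₂ _+_ (if-¬T (k≢t₀ ∘ to (P⇔≡t₀ ≤-refl)))
                           (countBelow-unique k t₀ (≤∧≢⇒< (≤-pred t₀<1+k) (k≢t₀ ∘ sym)) (P⇔≡t₀ ∘ m<n⇒m<1+n))

countBelow-once-per-period : ∀ d {P : ℕ → Bool} t₀ → t₀ < d →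
  (∀ t → P (t + d) ≡ P t) → (∀ {t} → t < d → T (P t) ⇔ t ≡ t₀) → ∀ q → countBelow (q * d) P ≡ q
countBelow-once-per-period d {P} t₀ t₀<d P-periodic P⇔≡t₀ q = begin
  countBelow (q * d) P   ≡⟨ countBelow-periodic d P-periodic q ⟩
  q * countBelow d P     ≡⟨ cong (q *_) (countBelow-unique d t₀ t₀<d P⇔≡t₀) ⟩
  q * 1                  ≡⟨ *-identityʳ q ⟩
  q                      ∎
  where open ≡-Reasoning

countBelow-multiples : ∀ d .{{_ : NonZero d}} {P : ℕ → Bool} → (∀ t → T (P t) ⇔ d ∣ t) →
  ∀ q → countBelow (q * d) P ≡ q
countBelow-multiples d {P} P⇔d∣ = countBelow-once-per-period d 0 (>-nonZero⁻¹ d) periodic root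
  where
  periodic : ∀ t → P (t + d) ≡ P t
  periodic t = T-injective $ mk⇔
    (λ h → from (P⇔d∣ t) (∣m+n∣m⇒∣n (subst (d ∣_) (+-comm t d) (to (P⇔d∣ (t + d)) h)) ∣-refl))
    (λ h → from (P⇔d∣ (t + d)) (∣m∣n⇒∣m+n (to (P⇔d∣ t) h) ∣-refl))
  root : ∀ {t} → t < d → T (P t) ⇔ t ≡ 0
  root {zero}  _   = mk⇔ (const refl) (const (from (P⇔d∣ 0) (d ∣0)))
  root {suc t} t<d = mk⇔ (λ h → ⊥-elim (<⇒≱ t<d (∣⇒≤ (to (P⇔d∣ (suc t)) h)))) (λ ())

sumBelow-indicator : ∀ k K {f : ℕ → ℕ} {P : ℕ → Bool} →
  (∀ {i} → i < k → f i ≡ (if P i then K else 0)) → sumBelow k f ≡ K * countBelow k P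
sumBelow-indicator zero    K _  = sym (*-zeroʳ K)
sumBelow-indicator (suc k) K {P = P} f≡ =
  trans (cong₂ _+_ (f≡ ≤-refl) (sumBelow-indicator k K (f≡ ∘ m<n⇒m<1+n))) (step (P k))
  where
  step : ∀ b → (if b then K else 0) + K * countBelow k P ≡ K * ((if b then 1 else 0) + countBelow k P)
  step true  = sym (*-suc K _)
  step false = refl

sumBelow-cong : ∀ k {f g : ℕ → ℕ} → (∀ i → f i ≡ g i) → sumBelow k f ≡ sumBelow k g
sumBelow-cong zero    _   = refl
sumBelow-cong (suc k) f≗g = cong₂ _+_ (f≗g k) (sumBelow-cong k f≗g)

sumBelow-+-* : ∀ k (f g : ℕ → ℕ) d → sumBelow k (λ j → f j + d * g j) ≡ sumBelow k f + d * sumBelow k g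
sumBelow-+-* zero    f g d = sym (*-zeroʳ d)
sumBelow-+-* (suc k) f g d =
  trans (cong (f k + d * g k +_) (sumBelow-+-* k f g d)) (regroup (f k) (g k) (sumBelow k f) (sumBelow k g) d)
  where
  regroup : ∀ a b c e d → a + d * b + (c + d * e) ≡ a + c + d * (b + e)
  regroup = solve-∀

sumBelow-id-odd : ∀ h → sumBelow (1 + h * 2) (λ j → j) ≡ (1 + h * 2) * h
sumBelow-id-odd zero    = refl
sumBelow-id-odd (suc h) = trans (cong (λ s → 2 + h * 2 + (1 + h * 2 + s)) (sumBelow-id-odd h)) (regroup h)
  where
  regroup : ∀ h → 2 + h * 2 + (1 + h * 2 + (1 + h * 2) * h) ≡ (1 + (1 + h) * 2) * (1 + h)
  regroup = solve-∀

-- Congruences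

≡[mod]⇔∣ : ∀ m a t → (a + t ≡[mod m ] a) ⇔ m ∣ t
≡[mod]⇔∣ zero a t = mk⇔
  (λ a+t≡a → subst (0 ∣_) (sym (+-cancelˡ-≡ a t 0 (trans a+t≡a (sym (+-identityʳ a))))) (0 ∣0))
  (λ 0∣t → trans (cong (a +_) (0∣⇒≡0 0∣t)) (+-identityʳ a))
≡[mod]⇔∣ m@(suc _) a t = mk⇔ %≡⇒∣ (%-remove-+ʳ a)
  where
  %≡⇒∣ : (a + t) % m ≡ a % m → m ∣ t
  %≡⇒∣ eq = divides ((a + t) / m ∸ a / m) $ begin
    t
      ≡⟨ m+n∸m≡n a t ⟨
    (a + t) ∸ a
      ≡⟨ cong₂ _∸_ (m≡m%n+[m/n]*n (a + t) m) (m≡m%n+[m/n]*n a m) ⟩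
    ((a + t) % m + (a + t) / m * m) ∸ (a % m + a / m * m)
      ≡⟨ cong (λ r → (r + (a + t) / m * m) ∸ (a % m + a / m * m)) eq ⟩
    (a % m + (a + t) / m * m) ∸ (a % m + a / m * m)
      ≡⟨ [m+n]∸[m+o]≡n∸o (a % m) _ _ ⟩
    (a + t) / m * m ∸ a / m * m
      ≡⟨ *-distribʳ-∸ m ((a + t) / m) (a / m) ⟨
    ((a + t) / m ∸ a / m) * m
      ∎
    where open ≡-Reasoning

≡[mod]1⇔∣∸1 : ∀ m → 0 < a → (a ≡[mod m ] 1) ⇔ m ∣ a ∸ 1
≡[mod]1⇔∣∸1 {a} m 0<a = subst (λ a′ → (a′ ≡[mod m ] 1) ⇔ m ∣ a ∸ 1) (m+[n∸m]≡n 0<a) (≡[mod]⇔∣ m 1 (a ∸ 1))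

T-≡ᵇ[mod] : ∀ m a b → T (a ≡ᵇ[mod m ] b) ⇔ (a ≡[mod m ] b)
T-≡ᵇ[mod] m a b = mk⇔ (≡ᵇ⇒≡ _ _) (≡⇒≡ᵇ _ _)

∣md⇔∣ : ∀ m → d ∣ m → d ∣ md z m ⇔ d ∣ z
∣md⇔∣ zero    _   = mk⇔ (λ h → h) (λ h → h)
∣md⇔∣ (suc _) d∣m = mk⇔ (∣n∣m%n⇒∣m d∣m) (λ d∣z → %-presˡ-∣ d∣z d∣m)

md-< : z < m → md z m ≡ z
md-< {m = suc _} z<m = m<n⇒m%n≡m z<m

*≡+[∸1]* : 0 < c → ∀ x → c * x ≡ x + (c ∸ 1) * x
*≡+[∸1]* 0<c x = cong (_* x) (sym (m+[n∸m]≡n 0<c))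

*∸1≡ : ∀ x y → 0 < x → 0 < y → x * y ∸ 1 ≡ (x ∸ 1) + x * (y ∸ 1)
*∸1≡ (suc x) (suc y) _ _ = regroup x y
  where
  regroup : ∀ x y → y + x * suc y ≡ x + suc x * y
  regroup = solve-∀

∣∸1⇒∣^∸1 : 0 < x → m ∣ x ∸ 1 → ∀ q → m ∣ x ^ q ∸ 1
∣∸1⇒∣^∸1         _   _     zero    = _ ∣0
∣∸1⇒∣^∸1 {x} {m} 0<x m∣x∸1 (suc q) =
  subst (m ∣_) (sym (*∸1≡ x (x ^ q) 0<x (m^n>0 x {{>-nonZero 0<x}} q)))
        (∣m∣n⇒∣m+n m∣x∸1 (∣n⇒∣m*n x (∣∸1⇒∣^∸1 0<x m∣x∸1 q)))

^*≡[1+^∸1]^ : 0 < x → ∀ a b → x ^ (a * b) ≡ (1 + (x ^ a ∸ 1)) ^ b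
^*≡[1+^∸1]^ {x} 0<x a b = begin
  x ^ (a * b)            ≡⟨ ^-*-assoc x a b ⟨
  (x ^ a) ^ b            ≡⟨ cong (_^ b) (m+[n∸m]≡n (m^n>0 x {{>-nonZero 0<x}} a)) ⟨
  (1 + (x ^ a ∸ 1)) ^ b  ∎
  where open ≡-Reasoning

-- Prime powers and valuations

prime>1 : Prime p → 1 < p
prime>1 {p} pp = nonTrivial⇒n>1 p {{prime⇒nonTrivial pp}}

prime^≢0 : Prime p → ∀ e → NonZero (p ^ e)
prime^≢0 {p} pp e = m^n≢0 p e {{prime⇒nonZero pp}}

1<p^ : Prime p → 1 ≤ n → 1 < p ^ n
1<p^ {p} pp 1≤n =
  ≤-trans (prime>1 pp) (≤-trans (≤-reflexive (sym (*-identityʳ p))) (^-monoʳ-≤ p {{prime⇒nonZero pp}} 1≤n))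

n<m^n : 1 < m → ∀ n → n < m ^ n
n<m^n     1<m zero    = z<s
n<m^n {m} 1<m (suc n) = ≤-<-trans (n<m^n 1<m n) (^-monoʳ-< m 1<m (n<1+n n))

odd-prime : Prime p → p ≢ 2 → p ≡ 1 + p / 2 * 2
odd-prime {p} pp p≢2 with p % 2 | m%n<n p 2 | m≡m%n+[m/n]*n p 2
... | 0 | _ | p≡[p/2]*2 with prime⇒irreducible pp (divides (p / 2) p≡[p/2]*2)
...   | inj₁ ()
...   | inj₂ 2≡p = ⊥-elim (p≢2 (sym 2≡p))
odd-prime pp p≢2 | 1           | _             | p≡1+[p/2]*2 = p≡1+[p/2]*2
odd-prime pp p≢2 | suc (suc _) | s≤s (s≤s ()) | _

odd-prime∤2 : Prime p → p ≢ 2 → ¬ p ∣ 2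
odd-prime∤2 pp p≢2 p∣2 = p≢2 (≤-antisym (∣⇒≤ p∣2) (prime>1 pp))

^-split : ∀ p → e ≤ f → p ^ f ≡ p ^ e * p ^ (f ∸ e)
^-split {e} {f} p e≤f = trans (cong (p ^_) (sym (m+[n∸m]≡n e≤f))) (^-distribˡ-+-* p e (f ∸ e))

^-monoʳ-∣ : ∀ p → e ≤ f → p ^ e ∣ p ^ f
^-monoʳ-∣ {e} {f} p e≤f = divides (p ^ (f ∸ e)) (trans (^-split p e≤f) (*-comm (p ^ e) _))

∣^ : ∀ p → 1 ≤ k → p ∣ p ^ k
∣^ {suc k} p _ = m∣m*n (p ^ k)

coprime-^ : Prime p → ¬ p ∣ u → ∀ k → Coprime u (p ^ k)
coprime-^ pp p∤u zero    (_ , d∣1)       = ∣1⇒≡1 d∣1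
coprime-^ pp p∤u (suc k) (d∣u , d∣p*p^k) = coprime-^ pp p∤u k (d∣u , coprime-divisor d⊥p d∣p*p^k)
  where
  d⊥p : Coprime _ _
  d⊥p (c∣d , c∣p) with prime⇒irreducible pp c∣p
  ... | inj₁ c≡1  = c≡1
  ... | inj₂ refl = ⊥-elim (p∤u (∣-trans c∣d d∣u))

^∣*-cancelʳ : Prime p → ¬ p ∣ u → ∀ k → p ^ k ∣ a * u ⇔ p ^ k ∣ a
^∣*-cancelʳ {p} {u} {a} pp p∤u k =
  mk⇔ (λ h → coprime-divisor (coprime-sym (coprime-^ pp p∤u k)) (subst (p ^ k ∣_) (*-comm a u) h))
      (∣m⇒∣m*n u)

^∣^*⇔ : Prime p → ¬ p ∣ u → p ^ e ∣ p ^ v * u ⇔ e ≤ v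
^∣^*⇔ {p} {u} {e} {v} pp p∤u = mk⇔ ∣⇒e≤v (λ e≤v → ∣m⇒∣m*n u (^-monoʳ-∣ p e≤v))
  where
  instance _ = prime^≢0 pp v
  ∣⇒e≤v : p ^ e ∣ p ^ v * u → e ≤ v
  ∣⇒e≤v h with e ≤? v
  ... | yes e≤v = e≤v
  ... | no  e≰v = ⊥-elim (p∤u (*-cancelˡ-∣ (p ^ v)
                    (subst (_∣ p ^ v * u) (*-comm p (p ^ v)) (∣-trans (^-monoʳ-∣ p (≰⇒> e≰v)) h))))

^∣*⇔ : Prime p → ¬ p ∣ u → ∀ k v → p ^ k ∣ a * (p ^ v * u) ⇔ p ^ (k ∸ v) ∣ a
^∣*⇔ {p} {u} {a} pp p∤u k v with v ≤? k
... | yes v≤k = mk⇔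
  (λ h → to (^∣*-cancelʳ pp p∤u (k ∸ v)) (*-cancelˡ-∣ (p ^ v) (subst₂ _∣_ (^-split p v≤k) regroup h)))
  (λ h → subst₂ _∣_ (sym (^-split p v≤k)) (sym regroup) (*-monoʳ-∣ (p ^ v) (∣m⇒∣m*n u h)))
  where
  instance _ = prime^≢0 pp v
  regroup : a * (p ^ v * u) ≡ p ^ v * (a * u)
  regroup = trans (sym (*-assoc a (p ^ v) u)) (trans (cong (_* u) (*-comm a (p ^ v))) (*-assoc (p ^ v) a u))
... | no  v≰k = mk⇔ (λ _ → subst (λ e → p ^ e ∣ a) (sym (m≤n⇒m∸n≡0 k≤v)) (1∣ a))
                    (λ _ → ∣n⇒∣m*n a (∣m⇒∣m*n u (^-monoʳ-∣ p k≤v)))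
  where k≤v = <⇒≤ (≰⇒> v≰k)

val≤ : ∀ p z n → val p z n ≤ n
val≤ p z zero    = z≤n
val≤ p z (suc n) with p ^ suc n ∣? z
... | yes _ = ≤-refl
... | no  _ = m≤n⇒m≤1+n (val≤ p z n)

p^val∣ : ∀ p z n → p ^ val p z n ∣ z
p^val∣ p z zero    = 1∣ z
p^val∣ p z (suc n) with p ^ suc n ∣? z
... | yes p^n∣z = p^n∣z
... | no  _     = p^val∣ p z n

≤val : ∀ p z n → e ≤ n → p ^ e ∣ z → e ≤ val p z n
≤val p z zero    e≤0   _     = e≤0
≤val p z (suc n) e≤1+n p^e∣z with p ^ suc n ∣? z
... | yes _ = e≤1+n
... | no  p^1+n∤z with m≤n⇒m<n∨m≡n e≤1+n
...   | inj₁ e<1+n = ≤val p z n (≤-pred e<1+n) p^e∣z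
...   | inj₂ refl  = ⊥-elim (p^1+n∤z p^e∣z)

^∣⇔≤val : ∀ p z n → e ≤ n → p ^ e ∣ z ⇔ e ≤ val p z n
^∣⇔≤val p z n e≤n = mk⇔ (≤val p z n e≤n) (λ e≤v → ∣-trans (^-monoʳ-∣ p e≤v) (p^val∣ p z n))

val-0 : ∀ p n → val p 0 n ≡ n
val-0 p n = ≤-antisym (val≤ p 0 n) (≤val p 0 n ≤-refl (_ ∣0))

val-cong : ∀ p {z z′} n → (∀ {e} → e ≤ n → p ^ e ∣ z ⇔ p ^ e ∣ z′) → val p z n ≡ val p z′ n
val-cong p {z} {z′} n z∼z′ = ≤-antisym
  (≤val p z′ n (val≤ p z n)  (to   (z∼z′ (val≤ p z n))  (p^val∣ p z n)))
  (≤val p z  n (val≤ p z′ n) (from (z∼z′ (val≤ p z′ n)) (p^val∣ p z′ n)))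

val-+p^ : ∀ p z n → val p (z + p ^ n) n ≡ val p z n
val-+p^ p z n = val-cong p n λ {e} e≤n → mk⇔
  (λ h → ∣m+n∣m⇒∣n (subst (p ^ e ∣_) (+-comm z _) h) (^-monoʳ-∣ p e≤n))
  (λ h → ∣m∣n⇒∣m+n h (^-monoʳ-∣ p e≤n))

val-md : ∀ p z n → val p (md z (p ^ n)) n ≡ val p z n
val-md p z n = val-cong p n λ e≤n → ∣md⇔∣ (p ^ n) (^-monoʳ-∣ p e≤n)

val<n : Prime p → z < p ^ n → z ≢ 0 → val p z n < n
val<n {p} {z} {n} pp z<p^n z≢0 with m≤n⇒m<n∨m≡n (val≤ p z n)
... | inj₁ v<n = v<n
... | inj₂ v≡n = ⊥-elim (<⇒≱ z<p^n (∣⇒≤ {{≢-nonZero z≢0}} (subst (λ e → p ^ e ∣ z) v≡n (p^val∣ p z n))))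

val-unit : Prime p → val p z n < n → ∃[ u ] z ≡ p ^ val p z n * u × ¬ p ∣ u
val-unit {p} {z} {n} pp v<n with p^val∣ p z n
... | divides u z≡u*p^v = u , trans z≡u*p^v (*-comm u _) , p∤u
  where
  p∤u : ¬ p ∣ u
  p∤u (divides c refl) = <-irrefl refl (<-≤-trans (n<1+n _) (≤val p z n v<n p^1+v∣z))
    where
    regroup : ∀ c p q → c * p * q ≡ c * (p * q)
    regroup = solve-∀
    p^1+v∣z : p ^ suc (val p z n) ∣ z
    p^1+v∣z = divides c (trans z≡u*p^v (regroup c p (p ^ val p z n)))

^∣*⇔^∸val∣ : Prime p → val p z n < n → ∀ k → p ^ k ∣ a * z ⇔ p ^ (k ∸ val p z n) ∣ a
^∣*⇔^∸val∣ {p} {z} {n} {a} pp v<n k with val-unit pp v<n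
... | u , z≡p^v*u , p∤u =
  subst (λ w → p ^ k ∣ a * w ⇔ p ^ (k ∸ val p z n) ∣ a) (sym z≡p^v*u) (^∣*⇔ pp p∤u k (val p z n))

-- Multiplicative orders

IsOrder⇒0< : 1 < m → IsOrder m a o → 0 < a
IsOrder⇒0< {a = suc _} _ _ = z<s
IsOrder⇒0< {m} {zero} {suc o} 1<m (_ , 0≡1 , _)
  with trans (sym (md-< (<-trans z<s 1<m))) (trans 0≡1 (md-< 1<m))
... | ()

IsOrder-∣ : IsOrder m a o → 0 < a → ∀ i → m ∣ a ^ i ∸ 1 ⇔ o ∣ i
IsOrder-∣ {m} {a} {o} (0<o , a^o≡1 , minimal) 0<a i = mk⇔ ∣⇒o∣ o∣⇒∣
  where
  instance _ = >-nonZero 0<o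
  0<a^ : ∀ e → 0 < a ^ e
  0<a^ = m^n>0 a {{>-nonZero 0<a}}
  m∣a^[q*o]∸1 : ∀ q → m ∣ a ^ (q * o) ∸ 1
  m∣a^[q*o]∸1 q = subst (λ e → m ∣ a ^ e ∸ 1) (*-comm o q)
    (subst (m ∣_) (cong (_∸ 1) (^-*-assoc a o q))
      (∣∸1⇒∣^∸1 (0<a^ o) (to (≡[mod]1⇔∣∸1 m (0<a^ o)) a^o≡1) q))
  o∣⇒∣ : o ∣ i → m ∣ a ^ i ∸ 1
  o∣⇒∣ (divides q refl) = m∣a^[q*o]∸1 q
  ∣⇒o∣ : m ∣ a ^ i ∸ 1 → o ∣ i
  ∣⇒o∣ m∣a^i∸1 with i % o ≟ 0
  ... | yes r≡0 = m%n≡0⇒n∣m i o r≡0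
  ... | no  r≢0 = ⊥-elim (<⇒≱ (m%n<n i o) (minimal r (n≢0⇒n>0 r≢0) (from (≡[mod]1⇔∣∸1 m (0<a^ r)) m∣a^r∸1)))
    where
    r = i % o
    a^i∸1≡ : a ^ i ∸ 1 ≡ (a ^ r ∸ 1) + a ^ r * (a ^ (i / o * o) ∸ 1)
    a^i∸1≡ = begin
      a ^ i ∸ 1                                     ≡⟨ cong (λ e → a ^ e ∸ 1) (m≡m%n+[m/n]*n i o) ⟩
      a ^ (r + i / o * o) ∸ 1                       ≡⟨ cong (_∸ 1) (^-distribˡ-+-* a r (i / o * o)) ⟩
      a ^ r * a ^ (i / o * o) ∸ 1                   ≡⟨ *∸1≡ (a ^ r) _ (0<a^ r) (0<a^ (i / o * o)) ⟩
      (a ^ r ∸ 1) + a ^ r * (a ^ (i / o * o) ∸ 1)   ∎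
      where open ≡-Reasoning
    m∣a^r∸1 : m ∣ a ^ r ∸ 1
    m∣a^r∸1 = ∣m+n∣m⇒∣n (subst (m ∣_) (trans a^i∸1≡ (+-comm (a ^ r ∸ 1) _)) m∣a^i∸1)
                        (∣n⇒∣m*n (a ^ r) (m∣a^[q*o]∸1 (i / o)))

∣-ext : (∀ i → a ∣ i ⇔ b ∣ i) → a ≡ b
∣-ext {a} {b} a∼b = ∣-antisym (from (a∼b b) ∣-refl) (to (a∼b a) ∣-refl)

IsOrder-unique : IsOrder m a o → IsOrder m a t → o ≡ t
IsOrder-unique (0<o , a^o≡1 , o-min) (0<t , a^t≡1 , t-min) = ≤-antisym (o-min _ 0<t a^t≡1) (t-min _ 0<o a^o≡1)

IsOrder-1 : ∀ m → IsOrder m 1 1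
IsOrder-1 m = z<s , refl , λ _ 0<j _ → 0<j

IsOrder-[a∸1] : 2 ≤ a → m ∣ a → ¬ m ∣ 2 → IsOrder m (a ∸ 1) 2
IsOrder-[a∸1] {suc (suc t)} {m} (s≤s (s≤s _)) m∣2+t m∤2 = z<s , square≡1 , minimal
  where
  square : ∀ t → (1 + t) * ((1 + t) * 1) ≡ 1 + t * (2 + t)
  square = solve-∀
  square≡1 : (1 + t) ^ 2 ≡[mod m ] 1
  square≡1 = subst (λ x → x ≡[mod m ] 1) (sym (square t)) (from (≡[mod]⇔∣ m 1 (t * (2 + t))) (∣n⇒∣m*n t m∣2+t))
  minimal : ∀ j → 0 < j → (1 + t) ^ j ≡[mod m ] 1 → 2 ≤ j
  minimal (suc (suc _)) _ _ = s≤s (s≤s z≤n)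
  minimal 1 _ [1+t]^1≡1 = ⊥-elim (m∤2 (∣m+n∣m⇒∣n (subst (m ∣_) (+-comm 2 t) m∣2+t) m∣t))
    where
    m∣t : m ∣ t
    m∣t = to (≡[mod]⇔∣ m 1 t) (subst (λ x → x ≡[mod m ] 1) (*-identityʳ (1 + t)) [1+t]^1≡1)

IsOrder-[p^n∸1] : Prime p → p ≢ 2 → 1 ≤ k → k ≤ n → IsOrder (p ^ k) (p ^ n ∸ 1) 2
IsOrder-[p^n∸1] {p} pp p≢2 1≤k k≤n =
  IsOrder-[a∸1] (1<p^ pp (≤-trans 1≤k k≤n)) (^-monoʳ-∣ p k≤n) (odd-prime∤2 pp p≢2 ∘ ∣-trans (∣^ p 1≤k))

IsOrder-±1 : ∀ {ε} → Prime p → p ≢ 2 → 1 ≤ n → ε ≡ 1 ⊎ ε ≡ p ^ n ∸ 1 → IsOrder (p ^ n) ε o →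
  1 ≤ k → k ≤ n → IsOrder (p ^ k) ε o
IsOrder-±1 {p} {n} {o} {k} pp p≢2 1≤n (inj₁ refl) ord 1≤k k≤n =
  subst (IsOrder (p ^ k) 1) (IsOrder-unique {p ^ n} {1} (IsOrder-1 (p ^ n)) ord) (IsOrder-1 (p ^ k))
IsOrder-±1 {p} {n} {o} {k} pp p≢2 1≤n (inj₂ refl) ord 1≤k k≤n =
  subst (IsOrder (p ^ k) (p ^ n ∸ 1))
        (IsOrder-unique {p ^ n} {p ^ n ∸ 1} (IsOrder-[p^n∸1] pp p≢2 1≤n ≤-refl) ord)
        (IsOrder-[p^n∸1] pp p≢2 1≤k k≤n)

IsOrder-±1-coprime : ∀ {ε} → Prime p → p ≢ 2 → 1 ≤ n → ε ≡ 1 ⊎ ε ≡ p ^ n ∸ 1 → IsOrder (p ^ n) ε o →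
  ∀ a → Coprime o (p ^ a)
IsOrder-±1-coprime {p} {n} pp p≢2 1≤n (inj₁ refl) ord a =
  subst (λ o → Coprime o (p ^ a)) (IsOrder-unique {p ^ n} {1} (IsOrder-1 (p ^ n)) ord) (1-coprimeTo _)
IsOrder-±1-coprime {p} {n} pp p≢2 1≤n (inj₂ refl) ord a =
  subst (λ o → Coprime o (p ^ a))
        (IsOrder-unique {p ^ n} {p ^ n ∸ 1} (IsOrder-[p^n∸1] pp p≢2 1≤n ≤-refl) ord)
        (coprime-^ pp (odd-prime∤2 pp p≢2) a)

lcm≢0 : ∀ m n .{{_ : NonZero m}} .{{_ : NonZero n}} → NonZero (lcm m n)
lcm≢0 m n = ≢-nonZero λ lcm≡0 →
  ≢-nonZero⁻¹ (m * n) {{m*n≢0 m n}} (0∣⇒≡0 (subst (_∣ m * n) lcm≡0 (lcm-least (m∣m*n {m} n) (n∣m*n m))))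

lcm∣⇔ : ∀ m n → lcm m n ∣ i ⇔ (m ∣ i × n ∣ i)
lcm∣⇔ m n = mk⇔ (λ h → ∣-trans (m∣lcm[m,n] m n) h , ∣-trans (n∣lcm[m,n] m n) h)
                (λ (m∣i , n∣i) → lcm-least m∣i n∣i)

lcm-*-coprime : ∀ a b c .{{_ : NonZero b}} → Coprime c b → lcm (a * b) c ≡ lcm a c * b
lcm-*-coprime a b c c⊥b = ∣-antisym
  (lcm-least (*-monoˡ-∣ b (m∣lcm[m,n] a c)) (∣-trans (n∣lcm[m,n] a c) (m∣m*n b)))
  lcm[a,c]*b∣
  where
  lcm[a,c]*b∣ : lcm a c * b ∣ lcm (a * b) c
  lcm[a,c]*b∣ with ∣-trans (n∣m*n a) (m∣lcm[m,n] (a * b) c)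
  ... | divides q ℓ≡q*b = subst (lcm a c * b ∣_) (sym ℓ≡q*b) (*-monoˡ-∣ b (lcm-least a∣q c∣q))
    where
    a∣q : a ∣ q
    a∣q = *-cancelʳ-∣ b (subst (a * b ∣_) ℓ≡q*b (m∣lcm[m,n] (a * b) c))
    c∣q : c ∣ q
    c∣q = coprime-divisor c⊥b (subst (c ∣_) (trans ℓ≡q*b (*-comm q b)) (n∣lcm[m,n] (a * b) c))

-- Lifting the exponent

geometricSum : ℕ → ℕ → ℕ
geometricSum d t = sumBelow t ((1 + d) ^_)

[1+d]^≡ : ∀ d t → (1 + d) ^ t ≡ 1 + d * geometricSum d t
[1+d]^≡ d zero    = cong (1 +_) (sym (*-zeroʳ d))
[1+d]^≡ d (suc t) = begin
  (1 + d) * (1 + d) ^ t       ≡⟨ cong ((1 + d) *_) ([1+d]^≡ d t) ⟩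
  (1 + d) * (1 + d * S)       ≡⟨ regroup d S ⟩
  1 + d * ((1 + d * S) + S)   ≡⟨ cong (λ x → 1 + d * (x + S)) ([1+d]^≡ d t) ⟨
  1 + d * ((1 + d) ^ t + S)   ∎
  where
  open ≡-Reasoning
  S = geometricSum d t
  regroup : ∀ d s → (1 + d) * (1 + d * s) ≡ 1 + d * ((1 + d * s) + s)
  regroup = solve-∀

[1+d]^∸1≡ : ∀ d t → (1 + d) ^ t ∸ 1 ≡ d * geometricSum d t
[1+d]^∸1≡ d t = cong (_∸ 1) ([1+d]^≡ d t)

d∣[1+d]^∸1 : ∀ d t → d ∣ (1 + d) ^ t ∸ 1
d∣[1+d]^∸1 d t = subst (d ∣_) (sym ([1+d]^∸1≡ d t)) (m∣m*n _)

geometricSum≡ : ∀ d t → geometricSum d t ≡ t + d * sumBelow t (geometricSum d)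
geometricSum≡ d zero    = sym (*-zeroʳ d)
geometricSum≡ d (suc t) = begin
  (1 + d) ^ t + S             ≡⟨ cong (_+ S) ([1+d]^≡ d t) ⟩
  (1 + d * S) + S             ≡⟨ cong ((1 + d * S) +_) (geometricSum≡ d t) ⟩
  (1 + d * S) + (t + d * R)   ≡⟨ regroup d S t R ⟩
  suc t + d * (S + R)         ∎
  where
  open ≡-Reasoning
  S = geometricSum d t
  R = sumBelow t (geometricSum d)
  regroup : ∀ d S t R → (1 + d * S) + (t + d * R) ≡ suc t + d * (S + R)
  regroup = solve-∀

-- Modulo d² the sum is p + d·p(p-1)/2, which is p modulo p² as p ∣ d and p is odd; so U ≡ 1 (mod p).
geometricSum-p : Prime p → p ≢ 2 → p ∣ d → ∃[ U ] geometricSum d p ≡ p * U × ¬ p ∣ U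
geometricSum-p {p} {d} pp p≢2 (divides c d≡c*p) = 1 + p * Z , S≡p*U , p∤U
  where
  h = p / 2
  W = sumBelow p (λ j → sumBelow j (geometricSum d))
  Z = c * h + c * c * W
  Σj≡p*h : sumBelow p (λ j → j) ≡ p * h
  Σj≡p*h = trans (cong (λ q → sumBelow q (λ j → j)) (odd-prime pp p≢2))
                 (trans (sumBelow-id-odd h) (cong (_* h) (sym (odd-prime pp p≢2))))
  regroup : ∀ p c h W → p + c * p * (p * h + c * p * W) ≡ p * (1 + p * (c * h + c * c * W))
  regroup = solve-∀
  S≡p*U : geometricSum d p ≡ p * (1 + p * Z)
  S≡p*U = begin
    geometricSum d p
      ≡⟨ geometricSum≡ d p ⟩
    p + d * sumBelow p (geometricSum d)
      ≡⟨ cong (λ R → p + d * R) (sumBelow-cong p (geometricSum≡ d)) ⟩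
    p + d * sumBelow p (λ j → j + d * sumBelow j (geometricSum d))
      ≡⟨ cong (λ R → p + d * R) (sumBelow-+-* p (λ j → j) _ d) ⟩
    p + d * (sumBelow p (λ j → j) + d * W)
      ≡⟨ cong (λ R → p + d * (R + d * W)) Σj≡p*h ⟩
    p + d * (p * h + d * W)
      ≡⟨ cong (λ d → p + d * (p * h + d * W)) d≡c*p ⟩
    p + c * p * (p * h + c * p * W)
      ≡⟨ regroup p c h W ⟩
    p * (1 + p * Z)
      ∎
    where open ≡-Reasoning
  p∤U : ¬ p ∣ 1 + p * Z
  p∤U p∣U = <⇒≢ (prime>1 pp) (sym (∣1⇒≡1 (∣m+n∣m⇒∣n (subst (p ∣_) (+-comm 1 _) p∣U) (m∣m*n Z))))

lte-coprime : Prime p → p ∣ d → ¬ p ∣ t → ∀ k → p ^ k ∣ (1 + d) ^ t ∸ 1 ⇔ p ^ k ∣ d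
lte-coprime {p} {d} {t} pp p∣d p∤t k =
  subst (λ x → p ^ k ∣ x ⇔ p ^ k ∣ d) (sym ([1+d]^∸1≡ d t)) (^∣*-cancelʳ pp p∤S k)
  where
  p∤S : ¬ p ∣ geometricSum d t
  p∤S p∣S = p∤t (∣m+n∣m⇒∣n (subst (p ∣_) (trans (geometricSum≡ d t) (+-comm t _)) p∣S) (∣m⇒∣m*n _ p∣d))

lte-p : Prime p → p ≢ 2 → p ∣ d → ∀ k → p ^ k ∣ (1 + d) ^ p ∸ 1 ⇔ p ^ (k ∸ 1) ∣ d
lte-p {p} {d} pp p≢2 p∣d k with geometricSum-p pp p≢2 p∣d
... | U , S≡p*U , p∤U = subst (λ x → p ^ k ∣ x ⇔ p ^ (k ∸ 1) ∣ d) (sym [1+d]^p∸1≡) (^∣*⇔ pp p∤U k 1)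
  where
  [1+d]^p∸1≡ : (1 + d) ^ p ∸ 1 ≡ d * (p ^ 1 * U)
  [1+d]^p∸1≡ = trans ([1+d]^∸1≡ d p) (cong (d *_) (trans S≡p*U (cong (_* U) (sym (*-identityʳ p)))))

lte-p^ : Prime p → p ≢ 2 → p ∣ d → ∀ s k → p ^ k ∣ (1 + d) ^ (p ^ s) ∸ 1 ⇔ p ^ (k ∸ s) ∣ d
lte-p^ {p} {d} pp p≢2 p∣d zero    k =
  subst (λ x → p ^ k ∣ x ∸ 1 ⇔ p ^ k ∣ d) (sym (*-identityʳ (1 + d))) ⇔-refl
lte-p^ {p} {d} pp p≢2 p∣d (suc s) k = begin
  p ^ k ∣ (1 + d) ^ (p * p ^ s) ∸ 1   ≡⟨ cong (λ x → p ^ k ∣ x ∸ 1) (trans (cong ((1 + d) ^_) (*-comm p (p ^ s)))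
                                                                         (^*≡[1+^∸1]^ z<s (p ^ s) p)) ⟩
  p ^ k ∣ (1 + E) ^ p ∸ 1             ≈⟨ lte-p pp p≢2 (∣-trans p∣d (d∣[1+d]^∸1 d (p ^ s))) k ⟩
  p ^ (k ∸ 1) ∣ E                     ≈⟨ lte-p^ pp p≢2 p∣d s (k ∸ 1) ⟩
  p ^ (k ∸ 1 ∸ s) ∣ d                 ≡⟨ cong (λ e → p ^ e ∣ d) (∸-+-assoc k 1 s) ⟩
  p ^ (k ∸ suc s) ∣ d                 ∎
  where
  open ⇔-Reasoning
  E = (1 + d) ^ (p ^ s) ∸ 1

∸≤-swap : ∀ k s v → k ∸ s ≤ v → k ∸ v ≤ s
∸≤-swap k s v k∸s≤v =
  m≤n+o⇒m∸n≤o k v (≤-trans (m≤n+m∸n k s) (≤-trans (+-monoʳ-≤ s k∸s≤v) (≤-reflexive (+-comm s v))))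

lte : Prime p → p ≢ 2 → p ∣ d → k ≤ n → ∀ q → p ^ k ∣ (1 + d) ^ q ∸ 1 ⇔ p ^ (k ∸ val p d n) ∣ q
lte pp p≢2 p∣d k≤n zero = mk⇔ (λ _ → _ ∣0) (λ _ → _ ∣0)
lte {p} {d} {k} {n} pp p≢2 p∣d k≤n q@(suc _)
  with val-unit {z = q} {n = q} pp (val<n pp (n<m^n (prime>1 pp) q) (λ ()))
... | t , q≡p^s*t , p∤t = begin
  p ^ k ∣ (1 + d) ^ q ∸ 1             ≡⟨ cong (λ x → p ^ k ∣ x ∸ 1)
                                             (trans (cong ((1 + d) ^_) q≡p^s*t) (^*≡[1+^∸1]^ z<s (p ^ s) t)) ⟩
  p ^ k ∣ (1 + E) ^ t ∸ 1             ≈⟨ lte-coprime pp (∣-trans p∣d (d∣[1+d]^∸1 d (p ^ s))) p∤t k ⟩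
  p ^ k ∣ E                           ≈⟨ lte-p^ pp p≢2 p∣d s k ⟩
  p ^ (k ∸ s) ∣ d                     ≈⟨ ^∣⇔≤val p d n (≤-trans (m∸n≤m k s) k≤n) ⟩
  k ∸ s ≤ val p d n                   ≈⟨ mk⇔ (∸≤-swap k s _) (∸≤-swap k _ s) ⟩
  k ∸ val p d n ≤ s                   ≈⟨ ^∣^*⇔ pp p∤t ⟨
  p ^ (k ∸ val p d n) ∣ p ^ s * t     ≡⟨ cong (p ^ (k ∸ val p d n) ∣_) q≡p^s*t ⟨
  p ^ (k ∸ val p d n) ∣ q             ∎
  where
  open ⇔-Reasoning
  s = val p q q
  E = (1 + d) ^ (p ^ s) ∸ 1

IsOrder-mod-p^ : Prime p → p ≢ 2 → IsOrder p a o → 0 < a → 1 ≤ k → k ≤ n →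
  ∀ i → p ^ k ∣ a ^ i ∸ 1 ⇔ o * p ^ (k ∸ val p (a ^ o ∸ 1) n) ∣ i
IsOrder-mod-p^ {p} {a} {o} {k} {n} pp p≢2 ord 0<a 1≤k k≤n i = mk⇔ ∣⇒order∣ order∣⇒∣
  where
  vₐ = val p (a ^ o ∸ 1) n
  lte-a : ∀ q → p ^ k ∣ a ^ (o * q) ∸ 1 ⇔ p ^ (k ∸ vₐ) ∣ q
  lte-a q = subst (λ x → p ^ k ∣ x ∸ 1 ⇔ p ^ (k ∸ vₐ) ∣ q) (sym (^*≡[1+^∸1]^ 0<a o q))
                  (lte pp p≢2 (from (IsOrder-∣ ord 0<a o) ∣-refl) k≤n q)
  ∣⇒order∣ : p ^ k ∣ a ^ i ∸ 1 → o * p ^ (k ∸ vₐ) ∣ i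
  ∣⇒order∣ h with to (IsOrder-∣ ord 0<a i) (∣-trans (∣^ p 1≤k) h)
  ... | divides q refl = subst (o * p ^ (k ∸ vₐ) ∣_) (*-comm o q)
          (*-monoʳ-∣ o (to (lte-a q) (subst (λ e → p ^ k ∣ a ^ e ∸ 1) (*-comm q o) h)))
  regroup : ∀ c o P → o * (c * P) ≡ c * (o * P)
  regroup = solve-∀
  order∣⇒∣ : o * p ^ (k ∸ vₐ) ∣ i → p ^ k ∣ a ^ i ∸ 1
  order∣⇒∣ (divides c refl) = subst (λ e → p ^ k ∣ a ^ e ∸ 1) (regroup c o (p ^ (k ∸ vₐ)))
                                    (from (lte-a (c * p ^ (k ∸ vₐ))) (n∣m*n c))

-- Linear congruences

affine-root : ∀ {u Q} .{{_ : NonZero Q}} → Coprime u Q → ∀ c → ∃[ j ] Q ∣ c + u * j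
affine-root {u} {Q@(suc Q′)} u⊥Q c with coprime-Bézout u⊥Q
... | Bézout.-+ x y 1+xu≡yQ = x * c , divides (c * y) (begin
  c + u * (x * c)      ≡⟨ regroup c u x ⟩
  c * (1 + x * u)      ≡⟨ cong (c *_) 1+xu≡yQ ⟩
  c * (y * Q)          ≡⟨ *-assoc c y Q ⟨
  c * y * Q            ∎)
  where
  open ≡-Reasoning
  regroup : ∀ c u x → c + u * (x * c) ≡ c * (1 + x * u)
  regroup = solve-∀
... | Bézout.+- x y 1+yQ≡xu = x * c * Q′ , divides (c + y * c * Q′) (begin
  c + u * (x * c * Q′)       ≡⟨ regroup₁ c u x Q′ ⟩
  c + x * u * c * Q′         ≡⟨ cong (λ z → c + z * c * Q′) 1+yQ≡xu ⟨
  c + (1 + y * Q) * c * Q′   ≡⟨ regroup₂ c y Q′ ⟩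
  (c + y * c * Q′) * Q       ∎)
  where
  open ≡-Reasoning
  regroup₁ : ∀ c u x Q′ → c + u * (x * c * Q′) ≡ c + x * u * c * Q′
  regroup₁ = solve-∀
  regroup₂ : ∀ c y Q′ → c + (1 + y * suc Q′) * c * Q′ ≡ (c + y * c * Q′) * suc Q′
  regroup₂ = solve-∀

affine-root-unique : ∀ {u Q j₁ j₂} → Coprime u Q → j₁ ≤ j₂ → j₂ < Q →
  Q ∣ c + u * j₁ → Q ∣ c + u * j₂ → j₁ ≡ j₂
affine-root-unique {c} {u} {Q} {j₁} {j₂} u⊥Q j₁≤j₂ j₂<Q root₁ root₂ with j₂ ∸ j₁ ≟ 0
... | yes δ≡0 = ≤-antisym j₁≤j₂ (m∸n≡0⇒m≤n δ≡0)
... | no  δ≢0 = ⊥-elim (<⇒≱ (≤-<-trans (m∸n≤m j₂ j₁) j₂<Q) (∣⇒≤ {{≢-nonZero δ≢0}} Q∣δ))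
  where
  regroup : ∀ c u a δ → c + u * (a + δ) ≡ (c + u * a) + u * δ
  regroup = solve-∀
  Q∣δ : Q ∣ j₂ ∸ j₁
  Q∣δ = coprime-divisor (coprime-sym u⊥Q)
    (∣m+n∣m⇒∣n (subst (Q ∣_) (trans (cong (λ j → c + u * j) (sym (m+[n∸m]≡n j₁≤j₂))) (regroup c u j₁ (j₂ ∸ j₁)))
                               root₂)
               root₁)

countBelow-affine : ∀ {u Q} .{{_ : NonZero Q}} → Coprime u Q → ∀ c q →
  countBelow (q * Q) (λ j → does (Q ∣? c + u * j)) ≡ q
countBelow-affine {u} {Q} u⊥Q c = countBelow-once-per-period Q j₀ (m%n<n j Q) periodic root⇔≡j₀
  where
  j = proj₁ (affine-root u⊥Q c)
  j₀ = j % Q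
  regroup : ∀ c u a b → c + u * (a + b) ≡ u * b + (c + u * a)
  regroup = solve-∀
  root-j₀ : Q ∣ c + u * j₀
  root-j₀ = ∣m+n∣m⇒∣n
    (subst (Q ∣_) (trans (cong (λ i → c + u * i) (m≡m%n+[m/n]*n j Q)) (regroup c u j₀ (j / Q * Q)))
                  (proj₂ (affine-root u⊥Q c)))
    (∣n⇒∣m*n u (n∣m*n (j / Q)))
  periodic : ∀ t → does (Q ∣? c + u * (t + Q)) ≡ does (Q ∣? c + u * t)
  periodic t = does-⇔ (mk⇔ (λ h → ∣m+n∣m⇒∣n (subst (Q ∣_) (regroup c u t Q) h) (n∣m*n u))
                           (λ h → subst (Q ∣_) (sym (regroup c u t Q)) (∣m∣n⇒∣m+n (n∣m*n u) h)))
                      (Q ∣? _) (Q ∣? _)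
  root⇔≡j₀ : ∀ {t} → t < Q → T (does (Q ∣? c + u * t)) ⇔ t ≡ j₀
  root⇔≡j₀ {t} t<Q = ⇔-trans (T-does (Q ∣? _)) (mk⇔ unique (λ { refl → root-j₀ }))
    where
    unique : Q ∣ c + u * t → t ≡ j₀
    unique root with ≤-total t j₀
    ... | inj₁ t≤j₀ = affine-root-unique u⊥Q t≤j₀ (m%n<n j Q) root root-j₀
    ... | inj₂ j₀≤t = sym (affine-root-unique u⊥Q j₀≤t t<Q root-j₀ root)

countBelow-p^g-affine : Prime p → ¬ p ∣ u → ∀ g r s D →
  countBelow (p ^ s * p ^ r) (λ j → does (p ^ (g + r) ∣? D + p ^ g * (u * j)))
    ≡ (if does (p ^ g ∣? D) then p ^ s else 0)
countBelow-p^g-affine {p} {u} pp p∤u g r s D with p ^ g ∣? D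
... | yes (divides c D≡c*p^g) =
  trans (countBelow-cong (p ^ s * p ^ r) (λ {j} _ → does-⇔ (cancel j) (p ^ (g + r) ∣? _) (p ^ r ∣? _)))
        (countBelow-affine {{prime^≢0 pp r}} (coprime-^ pp p∤u r) c (p ^ s))
  where
  factor : ∀ j → D + p ^ g * (u * j) ≡ p ^ g * (c + u * j)
  factor j = trans (cong (_+ p ^ g * (u * j)) (trans D≡c*p^g (*-comm c (p ^ g))))
                   (sym (*-distribˡ-+ (p ^ g) c (u * j)))
  cancel : ∀ j → p ^ (g + r) ∣ D + p ^ g * (u * j) ⇔ p ^ r ∣ c + u * j
  cancel j = mk⇔
    (λ h → *-cancelˡ-∣ (p ^ g) {{prime^≢0 pp g}} (subst₂ _∣_ (^-distribˡ-+-* p g r) (factor j) h))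
    (λ h → subst₂ _∣_ (sym (^-distribˡ-+-* p g r)) (sym (factor j)) (*-monoʳ-∣ (p ^ g) h))
... | no p^g∤D = countBelow-none (p ^ s * p ^ r) λ {j} _ h →
  p^g∤D (∣m+n∣m⇒∣n (subst (p ^ g ∣_) (+-comm D _) (∣-trans (^-monoʳ-∣ p (m≤m+n g r)) (to (T-does (_ ∣? _)) h)))
                   (m∣m*n (u * j)))

countBelow-p^b*j*y : Prime p → b ≤ n → y < p ^ n → ∀ D →
  countBelow (p ^ (n ∸ b)) (λ j → does (p ^ n ∣? D + p ^ b * j * y))
    ≡ (if does (p ^ (b + val p y n ⊓ (n ∸ b)) ∣? D) then p ^ (val p y n ⊓ (n ∸ b)) else 0)
countBelow-p^b*j*y {p} {b} {n} {y} pp b≤n y<p^n D with n ∸ b ≤? val p y n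
... | yes n∸b≤vy rewrite m≥n⇒m⊓n≡n n∸b≤vy | m+[n∸m]≡n b≤n =
  trans (countBelow-cong (p ^ (n ∸ b)) (λ _ → does-⇔ drop-p^b*j*y (p ^ n ∣? _) (p ^ n ∣? D)))
        (countBelow-const (p ^ (n ∸ b)) (does (p ^ n ∣? D)))
  where
  p^n∣p^b*j*y : ∀ {j} → p ^ n ∣ p ^ b * j * y
  p^n∣p^b*j*y {j} = subst₂ _∣_ (sym (^-split p b≤n)) (sym (*-assoc (p ^ b) j y))
                      (*-monoʳ-∣ (p ^ b) (∣n⇒∣m*n j (from (^∣⇔≤val p y n (m∸n≤m n b)) n∸b≤vy)))
  drop-p^b*j*y : ∀ {j} → p ^ n ∣ D + p ^ b * j * y ⇔ p ^ n ∣ D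
  drop-p^b*j*y = mk⇔ (λ h → ∣m+n∣m⇒∣n (subst (p ^ n ∣_) (+-comm D _) h) p^n∣p^b*j*y)
                     (λ h → ∣m∣n⇒∣m+n h p^n∣p^b*j*y)
... | no  n∸b≰vy with val-unit {z = y} pp (<-≤-trans (≰⇒> n∸b≰vy) (m∸n≤m n b))
...   | u , y≡p^vy*u , p∤u rewrite m≤n⇒m⊓n≡m (<⇒≤ (≰⇒> n∸b≰vy)) = begin
  countBelow (p ^ (n ∸ b)) (λ j → does (p ^ n ∣? D + p ^ b * j * y))
    ≡⟨ cong (λ K → countBelow K (λ j → does (p ^ n ∣? D + p ^ b * j * y))) (^-split p vy≤n∸b) ⟩
  countBelow (p ^ vy * p ^ r) (λ j → does (p ^ n ∣? D + p ^ b * j * y))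
    ≡⟨ countBelow-cong (p ^ vy * p ^ r) (λ {j} _ → cong₂ (λ e z → does (p ^ e ∣? D + z)) n≡b+vy+r (p^b*j*y≡ j))
     ⟩
  countBelow (p ^ vy * p ^ r) (λ j → does (p ^ (b + vy + r) ∣? D + p ^ (b + vy) * (u * j)))
    ≡⟨ countBelow-p^g-affine pp p∤u (b + vy) r vy D ⟩
  (if does (p ^ (b + vy) ∣? D) then p ^ vy else 0)
    ∎
  where
  open ≡-Reasoning
  vy = val p y n
  r = n ∸ b ∸ vy
  vy≤n∸b = <⇒≤ (≰⇒> n∸b≰vy)
  n≡b+vy+r : n ≡ b + vy + r
  n≡b+vy+r = begin
    n                ≡⟨ m+[n∸m]≡n b≤n ⟨
    b + (n ∸ b)      ≡⟨ cong (b +_) (m+[n∸m]≡n vy≤n∸b) ⟨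
    b + (vy + r)     ≡⟨ +-assoc b vy r ⟨
    b + vy + r       ∎
  regroup : ∀ P j Q u → P * j * (Q * u) ≡ P * Q * (u * j)
  regroup = solve-∀
  p^b*j*y≡ : ∀ j → p ^ b * j * y ≡ p ^ (b + vy) * (u * j)
  p^b*j*y≡ j = begin
    p ^ b * j * y              ≡⟨ cong (p ^ b * j *_) y≡p^vy*u ⟩
    p ^ b * j * (p ^ vy * u)   ≡⟨ regroup (p ^ b) j (p ^ vy) u ⟩
    p ^ b * p ^ vy * (u * j)   ≡⟨ cong (_* (u * j)) (^-distribˡ-+-* p b vy) ⟨
    p ^ (b + vy) * (u * j)     ∎

-- Stabilizers

fixable? : (p n α ε b x y i : ℕ) → Bool
fixable? p n α ε b x y i =
  does ((p ^ n ∣? (ε ^ i ∸ 1) * y) ×-dec (p ^ (b + val p y n ⊓ (n ∸ b)) ∣? (α ^ i ∸ 1) * x))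

T-fixesD : ∀ {α ε} → 0 < α → 0 < ε → ∀ p n b i j x y →
  T (fixesD p n α ε b i j x y) ⇔ (p ^ n ∣ (α ^ i ∸ 1) * x + p ^ b * j * y × p ^ n ∣ (ε ^ i ∸ 1) * y)
T-fixesD {α} {ε} 0<α 0<ε p n b i j x y = ⇔-trans (T-if-then-false _) (fixes-x ×-⇔ fixes-y)
  where
  N = p ^ n
  Z = p ^ b * j * y
  α^i*x+Z≡ : α ^ i * x + Z ≡ x + ((α ^ i ∸ 1) * x + Z)
  α^i*x+Z≡ = trans (cong (_+ Z) (*≡+[∸1]* (m^n>0 α {{>-nonZero 0<α}} i) x)) (+-assoc x _ Z)
  fixes-x : T (α ^ i * x + Z ≡ᵇ[mod N ] x) ⇔ N ∣ (α ^ i ∸ 1) * x + Z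
  fixes-x = ⇔-trans (T-≡ᵇ[mod] N _ x)
    (subst (λ w → (w ≡[mod N ] x) ⇔ N ∣ (α ^ i ∸ 1) * x + Z) (sym α^i*x+Z≡) (≡[mod]⇔∣ N x _))
  fixes-y : T (ε ^ i * y ≡ᵇ[mod N ] y) ⇔ N ∣ (ε ^ i ∸ 1) * y
  fixes-y = ⇔-trans (T-≡ᵇ[mod] N _ y)
    (subst (λ w → (w ≡[mod N ] y) ⇔ N ∣ (ε ^ i ∸ 1) * y) (sym (*≡+[∸1]* (m^n>0 ε {{>-nonZero 0<ε}} i) y))
           (≡[mod]⇔∣ N y _))

countBelow-fixesD : ∀ {α ε} → Prime p → 0 < α → 0 < ε → b ≤ n → y < p ^ n → ∀ x i →
  countBelow (p ^ (n ∸ b)) (λ j → fixesD p n α ε b i j x y)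
    ≡ (if fixable? p n α ε b x y i then p ^ (val p y n ⊓ (n ∸ b)) else 0)
countBelow-fixesD {p} {b} {n} {y} {α} {ε} pp 0<α 0<ε b≤n y<p^n x i with p ^ n ∣? (ε ^ i ∸ 1) * y
... | yes fixes-y = trans
  (countBelow-cong (p ^ (n ∸ b)) λ {j} _ → T-injective
    (⇔-trans (T-fixesD 0<α 0<ε p n b i j x y) (⇔-trans (mk⇔ proj₁ (_, fixes-y)) (⇔-sym (T-does (p ^ n ∣? _))))))
  (countBelow-p^b*j*y pp b≤n y<p^n ((α ^ i ∸ 1) * x))
... | no ¬fixes-y =
  countBelow-none (p ^ (n ∸ b)) λ _ h → ¬fixes-y (proj₂ (to (T-fixesD 0<α 0<ε p n b i _ x y) h))

stabD≡ : ∀ {α ε} → Prime p → 0 < α → 0 < ε → b ≤ n → y < p ^ n → ∀ L x →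
  stabD p n α ε b L x y ≡ p ^ (val p y n ⊓ (n ∸ b)) * countBelow L (fixable? p n α ε b x y)
stabD≡ {p} {b} {n} {y} pp 0<α 0<ε b≤n y<p^n L x =
  sumBelow-indicator L (p ^ (val p y n ⊓ (n ∸ b))) (λ {i} _ → countBelow-fixesD pp 0<α 0<ε b≤n y<p^n x i)

stabI≡ : Prime p → b ≤ n → y < p ^ n → ∀ x → stabI p n b x y ≡ p ^ (val p y n ⊓ (n ∸ b))
stabI≡ {p} {b} {n} {y} pp b≤n y<p^n x =
  trans (countBelow-fixesD {α = 1} {ε = 1} pp z<s z<s b≤n y<p^n x 0)
        (if-T (from (T-does ((p ^ n ∣? 0) ×-dec (p ^ (b + val p y n ⊓ (n ∸ b)) ∣? 0))) (_ ∣0 , _ ∣0)))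

∸-∸-⊓ : ∀ n k v → (n ∸ v) ∸ (k ∸ v) ≡ (n ∸ k) ⊓ (n ∸ v)
∸-∸-⊓ n       k       zero    = sym (m≤n⇒m⊓n≡m (m∸n≤m n k))
∸-∸-⊓ n       zero    (suc v) = sym (m≥n⇒m⊓n≡n (m∸n≤m n (suc v)))
∸-∸-⊓ zero    (suc k) (suc v) = 0∸n≡0 (k ∸ v)
∸-∸-⊓ (suc n) (suc k) (suc v) = ∸-∸-⊓ n k v

+[∸[∸]]≡∸+ : ∀ {n b m x} → b + m ≤ n → x ≤ b + m → m + (n ∸ (b + m ∸ x)) ≡ n ∸ b + x
+[∸[∸]]≡∸+ {n} {b} {m} {x} g≤n x≤g = begin
  m + (n ∸ (g ∸ x))               ≡⟨ cong (λ z → m + (z ∸ (g ∸ x))) (m+[n∸m]≡n g≤n) ⟨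
  m + ((g + (n ∸ g)) ∸ (g ∸ x))   ≡⟨ cong (m +_) (+-∸-comm (n ∸ g) (m∸n≤m g x)) ⟩
  m + ((g ∸ (g ∸ x)) + (n ∸ g))   ≡⟨ cong (λ z → m + (z + (n ∸ g))) (m∸[m∸n]≡n x≤g) ⟩
  m + (x + (n ∸ g))               ≡⟨ regroup m x (n ∸ g) ⟩
  (m + (n ∸ g)) + x               ≡⟨ cong (_+ x) m+[n∸g]≡n∸b ⟩
  n ∸ b + x                       ∎
  where
  open ≡-Reasoning
  g = b + m
  regroup : ∀ m x w → m + (x + w) ≡ (m + w) + x
  regroup = solve-∀
  m+[n∸g]≡n∸b : m + (n ∸ g) ≡ n ∸ b
  m+[n∸g]≡n∸b = trans (cong (m +_) (sym (∸-+-assoc n b m)))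
                      (m+[n∸m]≡n (m+n≤o⇒m≤o∸n m (subst (_≤ n) (+-comm b m) g≤n)))

stab-exponent : ∀ n b vx vy vα → b ≤ n → vx ≤ b + vy ⊓ (n ∸ b) → (vx ≡ 0 ⊎ vy ≡ 0) →
  vy ⊓ (n ∸ b) + ((n ∸ vα) ∸ ((b + vy ⊓ (n ∸ b) ∸ vx) ∸ vα)) ≡ (n ∸ b + vx) ⊓ (n ∸ vα + vy)
stab-exponent n b vx vy vα b≤n vx≤b+μ w∈W = begin
  μ + ((n ∸ vα) ∸ ((b + μ ∸ vx) ∸ vα))        ≡⟨ cong (μ +_) (∸-∸-⊓ n (b + μ ∸ vx) vα) ⟩
  μ + ((n ∸ (b + μ ∸ vx)) ⊓ (n ∸ vα))         ≡⟨ +-distribˡ-⊓ μ _ _ ⟩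
  (μ + (n ∸ (b + μ ∸ vx))) ⊓ (μ + (n ∸ vα))   ≡⟨ cong (_⊓ (μ + (n ∸ vα))) (+[∸[∸]]≡∸+ b+μ≤n vx≤b+μ) ⟩
  (n ∸ b + vx) ⊓ (μ + (n ∸ vα))               ≡⟨ min-with-vy ⟩
  (n ∸ b + vx) ⊓ (n ∸ vα + vy)                ∎
  where
  open ≡-Reasoning
  μ = vy ⊓ (n ∸ b)
  b+μ≤n : b + μ ≤ n
  b+μ≤n = ≤-trans (+-monoʳ-≤ b (m⊓n≤n vy (n ∸ b))) (≤-reflexive (m+[n∸m]≡n b≤n))
  min-with-vy : (n ∸ b + vx) ⊓ (μ + (n ∸ vα)) ≡ (n ∸ b + vx) ⊓ (n ∸ vα + vy)
  min-with-vy with vy ≤? n ∸ b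
  ... | yes vy≤n∸b rewrite m≤n⇒m⊓n≡m vy≤n∸b = cong ((n ∸ b + vx) ⊓_) (+-comm vy (n ∸ vα))
  ... | no  vy≰n∸b rewrite m≥n⇒m⊓n≡n (<⇒≤ (≰⇒> vy≰n∸b)) =
    trans (m≤n⇒m⊓n≡m (≤-trans (≤-reflexive n∸b+vx≡n∸b) (m≤m+n (n ∸ b) _)))
          (sym (m≤n⇒m⊓n≡m (≤-trans (≤-reflexive n∸b+vx≡n∸b) (≤-trans (<⇒≤ (≰⇒> vy≰n∸b)) (m≤n+m vy _)))))
    where
    vx≡0 : vx ≡ 0
    vx≡0 = [ (λ vx≡0 → vx≡0) , (λ vy≡0 → ⊥-elim (vy≰n∸b (subst (_≤ n ∸ b) (sym vy≡0) z≤n))) ]′ w∈W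
    n∸b+vx≡n∸b : n ∸ b + vx ≡ n ∸ b
    n∸b+vx≡n∸b = trans (cong (n ∸ b +_) vx≡0) (+-identityʳ _)

module Stabilizer
  {p n α ε b₁ oα oε oᾱ : ℕ} (pp : Prime p) (p≢2 : p ≢ 2) (1≤n : 1 ≤ n) (b₁≤n : b₁ ≤ n)
  (ε≡±1 : ε ≡ 1 ⊎ ε ≡ p ^ n ∸ 1)
  (ordα : IsOrder (p ^ n) α oα) (ordε : IsOrder (p ^ n) ε oε) (ordᾱ : IsOrder p α oᾱ)
  where

  private
    N = p ^ n
    L = lcm oα oε
    vα = val p (md (α ^ oᾱ + p ^ n ∸ 1) (p ^ n)) n
    instance
      p≢0  = prime⇒nonZero pp
      oα≢0 = >-nonZero (proj₁ ordα)
      oε≢0 = >-nonZero (proj₁ ordε)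
      oᾱ≢0 = >-nonZero (proj₁ ordᾱ)

    0<α : 0 < α
    0<α = IsOrder⇒0< (1<p^ pp 1≤n) ordα

    0<ε : 0 < ε
    0<ε = IsOrder⇒0< (1<p^ pp 1≤n) ordε

    Fixable : ℕ → ℕ → ℕ → Set
    Fixable x y i = N ∣ (ε ^ i ∸ 1) * y × p ^ (b₁ + val p y n ⊓ (n ∸ b₁)) ∣ (α ^ i ∸ 1) * x

    count-fixable : ∀ {x y} d .{{_ : NonZero d}} q → L ≡ q * d → (∀ i → Fixable x y i ⇔ d ∣ i) →
      countBelow L (fixable? p n α ε b₁ x y) ≡ q
    count-fixable d q L≡q*d Fixable⇔d∣ =
      trans (cong (λ K → countBelow K _) L≡q*d)
            (countBelow-multiples d (λ i → ⇔-trans (T-does ((N ∣? _) ×-dec (_ ∣? _))) (Fixable⇔d∣ i)) q)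

    ε-fixes : ∀ {y} → y < N → y ≢ 0 → ∀ i → N ∣ (ε ^ i ∸ 1) * y ⇔ oε ∣ i
    ε-fixes {y} y<N y≢0 i = ⇔-trans (^∣*⇔^∸val∣ pp vy<n n)
      (IsOrder-∣ (IsOrder-±1 pp p≢2 1≤n ε≡±1 ordε (m<n⇒0<n∸m vy<n) (m∸n≤m n (val p y n))) 0<ε i)
      where
      vy<n : val p y n < n
      vy<n = val<n pp y<N y≢0

    vα≡ : vα ≡ val p (α ^ oᾱ ∸ 1) n
    vα≡ = begin
      val p (md (α ^ oᾱ + N ∸ 1) N) n   ≡⟨ val-md p _ n ⟩
      val p (α ^ oᾱ + N ∸ 1) n          ≡⟨ cong (λ z → val p z n) (+-∸-comm N (m^n>0 α {{>-nonZero 0<α}} oᾱ)) ⟩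
      val p (α ^ oᾱ ∸ 1 + N) n          ≡⟨ val-+p^ p _ n ⟩
      val p (α ^ oᾱ ∸ 1) n              ∎
      where open ≡-Reasoning

    α-fixes : ∀ {k} → 1 ≤ k → k ≤ n → ∀ i → p ^ k ∣ α ^ i ∸ 1 ⇔ oᾱ * p ^ (k ∸ vα) ∣ i
    α-fixes {k} 1≤k k≤n i = subst (λ v → p ^ k ∣ α ^ i ∸ 1 ⇔ oᾱ * p ^ (k ∸ v) ∣ i) (sym vα≡)
                                  (IsOrder-mod-p^ pp p≢2 ordᾱ 0<α 1≤k k≤n i)

    oε⊥p^ : ∀ a → Coprime oε (p ^ a)
    oε⊥p^ = IsOrder-±1-coprime pp p≢2 1≤n ε≡±1 ordε

    L≡ : ∀ {s} → s ≤ n ∸ vα → L ≡ p ^ (n ∸ vα ∸ s) * (lcm oᾱ oε * p ^ s)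
    L≡ {s} s≤n∸vα = begin
      lcm oα oε                                ≡⟨ cong (λ o → lcm o oε) oα≡ ⟩
      lcm (oᾱ * p ^ (n ∸ vα)) oε               ≡⟨ lcm-*-coprime oᾱ (p ^ (n ∸ vα)) oε {{m^n≢0 p (n ∸ vα)}}
                                                                (oε⊥p^ (n ∸ vα)) ⟩
      lcm oᾱ oε * p ^ (n ∸ vα)                 ≡⟨ cong (lcm oᾱ oε *_) (^-split p s≤n∸vα) ⟩
      lcm oᾱ oε * (p ^ s * p ^ (n ∸ vα ∸ s))   ≡⟨ regroup (lcm oᾱ oε) (p ^ s) _ ⟩
      p ^ (n ∸ vα ∸ s) * (lcm oᾱ oε * p ^ s)   ∎
      where
      open ≡-Reasoning
      oα≡ : oα ≡ oᾱ * p ^ (n ∸ vα)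
      oα≡ = ∣-ext λ i → ⇔-trans (⇔-sym (IsOrder-∣ ordα 0<α i)) (α-fixes 1≤n ≤-refl i)
      regroup : ∀ M A C → M * (A * C) ≡ C * (M * A)
      regroup = solve-∀

    μ₀≡n∸b₁ : val p 0 n ⊓ (n ∸ b₁) ≡ n ∸ b₁
    μ₀≡n∸b₁ = trans (cong (_⊓ (n ∸ b₁)) (val-0 p n)) (m≥n⇒m⊓n≡n (m∸n≤m n b₁))

    Fixable-y≡0 : ∀ {x} → val p x n ≡ 0 → ∀ i → Fixable x 0 i ⇔ oα ∣ i
    Fixable-y≡0 {x} vx≡0 i = begin
      Fixable x 0 i                         ≈⟨ mk⇔ proj₂ (subst (N ∣_) (sym (*-zeroʳ (ε ^ i ∸ 1))) (N ∣0) ,_) ⟩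
      p ^ (b₁ + val p 0 n ⊓ (n ∸ b₁)) ∣ (α ^ i ∸ 1) * x
                                            ≡⟨ cong (λ e → p ^ e ∣ (α ^ i ∸ 1) * x)
                                                    (trans (cong (b₁ +_) μ₀≡n∸b₁) (m+[n∸m]≡n b₁≤n)) ⟩
      N ∣ (α ^ i ∸ 1) * x                   ≈⟨ ^∣*⇔^∸val∣ pp (subst (_< n) (sym vx≡0) 1≤n) n ⟩
      p ^ (n ∸ val p x n) ∣ α ^ i ∸ 1       ≡⟨ cong (λ v → p ^ (n ∸ v) ∣ α ^ i ∸ 1) vx≡0 ⟩
      N ∣ α ^ i ∸ 1                         ≈⟨ IsOrder-∣ ordα 0<α i ⟩
      oα ∣ i                                ∎
      where open ⇔-Reasoning

    Fixable-vx<g : ∀ {x y} → y < N → y ≢ 0 → let g = b₁ + val p y n ⊓ (n ∸ b₁) in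
      val p x n < n → val p x n < g → g ≤ n → ∀ i → Fixable x y i ⇔ lcm oᾱ oε * p ^ (g ∸ val p x n ∸ vα) ∣ i
    Fixable-vx<g {x} {y} y<N y≢0 vx<n vx<g g≤n i = begin
      Fixable x y i                     ≈⟨ ε-fixes y<N y≢0 i ×-⇔ ⇔-trans (^∣*⇔^∸val∣ pp vx<n _)
                                             (α-fixes (m<n⇒0<n∸m vx<g) (≤-trans (m∸n≤m _ (val p x n)) g≤n) i) ⟩
      (oε ∣ i × oᾱ * p ^ s ∣ i)         ≈⟨ mk⇔ swap swap ⟩
      (oᾱ * p ^ s ∣ i × oε ∣ i)         ≈⟨ lcm∣⇔ (oᾱ * p ^ s) oε ⟨
      lcm (oᾱ * p ^ s) oε ∣ i           ≡⟨ cong (_∣ i) (lcm-*-coprime oᾱ (p ^ s) oε {{m^n≢0 p s}} (oε⊥p^ s)) ⟩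
      lcm oᾱ oε * p ^ s ∣ i             ∎
      where
      open ⇔-Reasoning
      s = b₁ + val p y n ⊓ (n ∸ b₁) ∸ val p x n ∸ vα

  stabD-y≡0 : ∀ {x} → val p x n ≡ 0 ⊎ val p 0 n ≡ 0 → stabD p n α ε b₁ L x 0 ≡ (L / oα) * p ^ (n ∸ b₁)
  stabD-y≡0 {x} w∈W = begin
    stabD p n α ε b₁ L x 0                                      ≡⟨ stabD≡ pp 0<α 0<ε b₁≤n (m^n>0 p n) L x ⟩
    p ^ (val p 0 n ⊓ (n ∸ b₁)) * countBelow L (fixable? p n α ε b₁ x 0)
      ≡⟨ cong₂ _*_ (cong (p ^_) μ₀≡n∸b₁)
                   (count-fixable oα (L / oα) (sym (m/n*n≡m (m∣lcm[m,n] oα oε))) (Fixable-y≡0 vx≡0)) ⟩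
    p ^ (n ∸ b₁) * (L / oα)                                     ≡⟨ *-comm (p ^ (n ∸ b₁)) _ ⟩
    (L / oα) * p ^ (n ∸ b₁)                                     ∎
    where
    open ≡-Reasoning
    vx≡0 : val p x n ≡ 0
    vx≡0 = [ (λ vx≡0 → vx≡0) , (λ v0≡0 → ⊥-elim (<⇒≢ 1≤n (sym (trans (sym (val-0 p n)) v0≡0)))) ]′ w∈W

  stabD-b₁+vy≤vx : ∀ {x y} → y < N → val p x n ≡ 0 ⊎ val p y n ≡ 0 → b₁ + val p y n ≤ val p x n →
    stabD p n α ε b₁ L x y ≡ (L / oε) * p ^ val p y n
  stabD-b₁+vy≤vx {x} {y} y<N w∈W b₁+vy≤vx = begin
    stabD p n α ε b₁ L x y                                      ≡⟨ stabD≡ pp 0<α 0<ε b₁≤n y<N L x ⟩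
    p ^ (vy ⊓ (n ∸ b₁)) * countBelow L (fixable? p n α ε b₁ x y)
      ≡⟨ cong₂ _*_ (cong (λ v → p ^ (v ⊓ (n ∸ b₁))) vy≡0)
                   (count-fixable oε (L / oε) (sym (m/n*n≡m (n∣lcm[m,n] oα oε))) Fixable⇔oε∣) ⟩
    1 * (L / oε)                                                ≡⟨ *-comm 1 (L / oε) ⟩
    (L / oε) * 1                                                ≡⟨ cong (λ v → (L / oε) * p ^ v) vy≡0 ⟨
    (L / oε) * p ^ vy                                           ∎
    where
    open ≡-Reasoning
    vy = val p y n
    vy≡0 : vy ≡ 0
    vy≡0 = [ (λ vx≡0 → n≤0⇒n≡0 (≤-trans (m≤n+m vy b₁) (subst (b₁ + vy ≤_) vx≡0 b₁+vy≤vx)))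
           , (λ vy≡0 → vy≡0)
           ]′ w∈W
    y≢0 : y ≢ 0
    y≢0 y≡0 = <⇒≢ 1≤n (sym (trans (sym (val-0 p n)) (trans (cong (λ z → val p z n) (sym y≡0)) vy≡0)))
    b₁+μ≤vx : b₁ + vy ⊓ (n ∸ b₁) ≤ val p x n
    b₁+μ≤vx = ≤-trans (+-monoʳ-≤ b₁ (m⊓n≤m vy (n ∸ b₁))) b₁+vy≤vx
    p^[b₁+μ]∣x : p ^ (b₁ + vy ⊓ (n ∸ b₁)) ∣ x
    p^[b₁+μ]∣x = from (^∣⇔≤val p x n (≤-trans b₁+μ≤vx (val≤ p x n))) b₁+μ≤vx
    Fixable⇔oε∣ : ∀ i → Fixable x y i ⇔ oε ∣ i
    Fixable⇔oε∣ i = ⇔-trans (mk⇔ proj₁ (_, ∣n⇒∣m*n (α ^ i ∸ 1) p^[b₁+μ]∣x)) (ε-fixes y<N y≢0 i)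

  stabD-vx<b₁+vy : ∀ {x y} → y < N → val p x n ≡ 0 ⊎ val p y n ≡ 0 → val p x n < b₁ + val p y n → y ≢ 0 →
    stabD p n α ε b₁ L x y ≡ p ^ ((n ∸ b₁ + val p x n) ⊓ (n ∸ vα + val p y n))
  stabD-vx<b₁+vy {x} {y} y<N w∈W vx<b₁+vy y≢0 = begin
    stabD p n α ε b₁ L x y
      ≡⟨ stabD≡ pp 0<α 0<ε b₁≤n y<N L x ⟩
    p ^ μ * countBelow L (fixable? p n α ε b₁ x y)
      ≡⟨ cong (p ^ μ *_) (count-fixable D (p ^ r) (L≡ s≤n∸vα) (Fixable-vx<g y<N y≢0 vx<n vx<g g≤n)) ⟩
    p ^ μ * p ^ r
      ≡⟨ ^-distribˡ-+-* p μ r ⟨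
    p ^ (μ + r)
      ≡⟨ cong (p ^_) (stab-exponent n b₁ vx vy vα b₁≤n (<⇒≤ vx<g) w∈W) ⟩
    p ^ ((n ∸ b₁ + vx) ⊓ (n ∸ vα + vy))
      ∎
    where
    open ≡-Reasoning
    vx = val p x n
    vy = val p y n
    μ = vy ⊓ (n ∸ b₁)
    g = b₁ + μ
    s = g ∸ vx ∸ vα
    r = n ∸ vα ∸ s
    D = lcm oᾱ oε * p ^ s
    instance
      D≢0 : NonZero D
      D≢0 = m*n≢0 (lcm oᾱ oε) (p ^ s) {{lcm≢0 oᾱ oε}} {{m^n≢0 p s}}
    vx<n : vx < n
    vx<n = [ (λ vx≡0 → subst (_< n) (sym vx≡0) 1≤n)
           , (λ vy≡0 → <-≤-trans (subst (λ v → vx < b₁ + v) vy≡0 vx<b₁+vy)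
                                  (subst (_≤ n) (sym (+-identityʳ b₁)) b₁≤n))
           ]′ w∈W
    g≡[b₁+vy]⊓n : g ≡ (b₁ + vy) ⊓ n
    g≡[b₁+vy]⊓n = trans (+-distribˡ-⊓ b₁ vy (n ∸ b₁)) (cong ((b₁ + vy) ⊓_) (m+[n∸m]≡n b₁≤n))
    vx<g : vx < g
    vx<g = subst₂ _<_ (⊓-idem vx) (sym g≡[b₁+vy]⊓n) (⊓-mono-< vx<b₁+vy vx<n)
    g≤n : g ≤ n
    g≤n = subst (_≤ n) (sym g≡[b₁+vy]⊓n) (m⊓n≤n (b₁ + vy) n)
    s≤n∸vα : s ≤ n ∸ vα
    s≤n∸vα = ∸-monoˡ-≤ vα (≤-trans (m∸n≤m g vx) g≤n)

lemma6p1 : (p n α ε b₁ b₂ oα oε oᾱ : ℕ) →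
  Prime p → ¬ (p ≡ 2) → 1 ≤ n →
  α < p ^ n → Coprime α (p ^ n) →
  (ε ≡ 1 ⊎ ε ≡ p ^ n ∸ 1) →
  b₁ ≤ b₂ → b₂ ≤ n →
  IsOrder (p ^ n) α oα → IsOrder (p ^ n) ε oε → IsOrder p α oᾱ →
  ⦃ _ : NonZero oα ⦄ → ⦃ _ : NonZero oε ⦄ →
  (x y : ℕ) → x < p ^ n → y < p ^ n →
  (val p x n ≡ 0 ⊎ val p y n ≡ 0) →
  ((y ≡ 0 →
      stabD p n α ε b₁ (lcm oα oε) x y ≡ (lcm oα oε / oα) * p ^ (n ∸ b₁))
   × (b₁ + val p y n ≤ val p x n →
      stabD p n α ε b₁ (lcm oα oε) x y ≡ (lcm oα oε / oε) * p ^ val p y n)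
   × (val p x n < b₁ + val p y n → ¬ (y ≡ 0) →
      stabD p n α ε b₁ (lcm oα oε) x y
        ≡ p ^ ((n ∸ b₁ + val p x n)
               ⊓ (n ∸ val p (md (α ^ oᾱ + p ^ n ∸ 1) (p ^ n)) n + val p y n))))
  × stabI p n b₂ x y ≡ p ^ (val p y n ⊓ (n ∸ b₂))
lemma6p1 p n α ε b₁ b₂ oα oε oᾱ pp p≢2 1≤n _ _ ε≡±1 b₁≤b₂ b₂≤n ordα ordε ordᾱ x y _ y<p^n w∈W =
  ( (λ { refl → stabD-y≡0 w∈W })
  , stabD-b₁+vy≤vx y<p^n w∈W
  , stabD-vx<b₁+vy y<p^n w∈W )
  , stabI≡ pp b₂≤n y<p^n x
  where open Stabilizer pp p≢2 1≤n (≤-trans b₁≤b₂ b₂≤n) ε≡±1 ordα ordε ordᾱ
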